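{- Let $(X,\odot,\ell,r)$ be an $\ell r$-multisemigroup and $A,B\subseteq X$. Then $\ell(A\odot B)\subseteq\ell(A\odot\ell(B))$ and $r(A\odot B)\subseteq r(r(A)\odot B)$. If $X$ is moreover local, the converse inclusions hold as well.
   Context: A multimagma is a non-empty set $X$ with $\odot:X\times X\to\mathcal{P}X$, extended to subsets by $A\odot B=\bigcup\{a\odot b\mid a\in A,b\in B\}$. $D_{xy}$ means $x\odot y\neq\emptyset$. An $\ell r$-multisemigroup is a multimagma with $\ell,r:X\to X$ such that $x\odot(y\odot z)=(x\odot y)\odot z$ for all $x,y,z$, and $D_{xy}\Rightarrow r(x)=\ell(y)$, $\ell(x)\odot x=\{x\}$, $x\odot r(x)=\{x\}$ for all $x,y$; it is local if $r(x)=\ell(y)\Rightarrow D_{xy}$ for all $x,y$. For $A\subseteq X$, $\ell(A)=\{\ell(a)\mid a\in A\}$, $r(A)=\{r(a)\mid a\in A\}$. -}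

module Defs where

open import Level using (Level; _⊔_; suc)
open import Data.Product using (Σ; ∃; ∃-syntax; _×_; _,_)
open import Relation.Binary.PropositionalEquality using (_≡_)
open import Relation.Nullary using (¬_)
open import Relation.Unary using (Pred; _⊆_; _∈_; ｛_｝)

-- A subset of X is a predicate on X (P X).
-- A multioperation x ⊙ y ∈ P X is given as a relation: z ∈ (x ⊙ y) iff mop x y z.
MultiOp : ∀ {a} (X : Set a) → Set (suc a)
MultiOp {a} X = X → X → Pred X a

_≐_ : ∀ {a} {X : Set a} → Pred X a → Pred X a → Set a
A ≐ B = (A ⊆ B) × (B ⊆ A)

module _ {a} {X : Set a} (_⊙_ : MultiOp X) where

  lift : Pred X a → Pred X a → Pred X a
  lift A B z = ∃[ x ] ∃[ y ] (x ∈ A × y ∈ B × z ∈ (x ⊙ y))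

  D : X → X → Set a
  D x y = ∃[ z ] (z ∈ (x ⊙ y))

image : ∀ {a} {X : Set a} → (X → X) → Pred X a → Pred X a
image f A z = ∃[ x ] (x ∈ A × f x ≡ z)

sing : ∀ {a} {X : Set a} → X → Pred X a
sing x z = z ≡ x

record IsLRMultisemigroup {a} {X : Set a} (_⊙_ : MultiOp X) (ℓ r : X → X) : Set (suc a) where
  field
    nonempty : X
    assoc    : ∀ x y z → lift _⊙_ (sing x) (y ⊙ z) ≐ lift _⊙_ (x ⊙ y) (sing z)
    D⇒r≡ℓ    : ∀ x y → D _⊙_ x y → r x ≡ ℓ y
    ℓ-unit   : ∀ x → (ℓ x ⊙ x) ≐ sing x
    r-unit   : ∀ x → (x ⊙ r x) ≐ sing x

IsLocal : ∀ {a} {X : Set a} (_⊙_ : MultiOp X) (ℓ r : X → X) → Set a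
IsLocal _⊙_ ℓ r = ∀ x y → r x ≡ ℓ y → D _⊙_ x y

{-# OPTIONS --safe #-}
-- Every product z ∈ x ⊙ y satisfies ℓ z = ℓ x and r z = r y: associativity on
-- ℓ z ⊙ (x ⊙ y) makes ℓ z composable with x, so ℓ z = r (ℓ z) = ℓ x (dually for r).
-- Hence ℓ(A ⊙ B) only sees the left factors x, and x ∈ x ⊙ ℓ y because ℓ y = r x;
-- locality is exactly what allows replacing the unit ℓ y by y again.
module Submission where

open import Defs
open import Data.Product using (_×_; _,_; proj₁; proj₂)
open import Relation.Unary using (Pred; _⊆_)
open import Relation.Binary.PropositionalEquality using (_≡_; refl; sym; trans; subst)

module LRMultisemigroupProperties
  {a} {X : Set a} {_⊙_ : MultiOp X} {ℓ r : X → X} (M : IsLRMultisemigroup _⊙_ ℓ r) where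

  open IsLRMultisemigroup M

  ℓ-⊙ : ∀ {x y z} → (x ⊙ y) z → ℓ z ≡ ℓ x
  ℓ-⊙ {x} {y} {z} z∈xy
    with proj₁ (assoc (ℓ z) x y) (ℓ z , z , refl , z∈xy , proj₂ (ℓ-unit z) refl)
  ... | u , _ , u∈ℓzx , refl , _ =
    trans (sym (D⇒r≡ℓ (ℓ z) z (z , proj₂ (ℓ-unit z) refl))) (D⇒r≡ℓ (ℓ z) x (u , u∈ℓzx))

  r-⊙ : ∀ {x y z} → (x ⊙ y) z → r z ≡ r y
  r-⊙ {x} {y} {z} z∈xy
    with proj₂ (assoc x y (r z)) (z , r z , z∈xy , refl , proj₂ (r-unit z) refl)
  ... | _ , u , refl , u∈yrz , _ =
    trans (D⇒r≡ℓ z (r z) (z , proj₂ (r-unit z) refl)) (sym (D⇒r≡ℓ y (r z) (u , u∈yrz)))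

  ℓ-idem : ∀ x → ℓ (ℓ x) ≡ ℓ x
  ℓ-idem x = sym (ℓ-⊙ (proj₂ (ℓ-unit x) refl))

  r-idem : ∀ x → r (r x) ≡ r x
  r-idem x = sym (r-⊙ (proj₂ (r-unit x) refl))

  ∈-⊙-ℓ : ∀ {x y} → D _⊙_ x y → (x ⊙ ℓ y) x
  ∈-⊙-ℓ {x} {y} Dxy = subst (λ u → (x ⊙ u) x) (D⇒r≡ℓ x y Dxy) (proj₂ (r-unit x) refl)

  ∈-r-⊙ : ∀ {x y} → D _⊙_ x y → (r x ⊙ y) y
  ∈-r-⊙ {x} {y} Dxy = subst (λ u → (u ⊙ y) y) (sym (D⇒r≡ℓ x y Dxy)) (proj₂ (ℓ-unit y) refl)

  module _ (A B : Pred X a) where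

    ℓ-⊙-⊆-ℓ-⊙-ℓ : image ℓ (lift _⊙_ A B) ⊆ image ℓ (lift _⊙_ A (image ℓ B))
    ℓ-⊙-⊆-ℓ-⊙-ℓ (z , (x , y , x∈A , y∈B , z∈xy) , refl) =
      x , (x , ℓ y , x∈A , (y , y∈B , refl) , ∈-⊙-ℓ (z , z∈xy)) , sym (ℓ-⊙ z∈xy)

    r-⊙-⊆-r-r-⊙ : image r (lift _⊙_ A B) ⊆ image r (lift _⊙_ (image r A) B)
    r-⊙-⊆-r-r-⊙ (z , (x , y , x∈A , y∈B , z∈xy) , refl) =
      y , (r x , y , (x , x∈A , refl) , y∈B , ∈-r-⊙ (z , z∈xy)) , sym (r-⊙ z∈xy)

    module _ (local : IsLocal _⊙_ ℓ r) where

      ℓ-⊙-ℓ-⊆-ℓ-⊙ : image ℓ (lift _⊙_ A (image ℓ B)) ⊆ image ℓ (lift _⊙_ A B)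
      ℓ-⊙-ℓ-⊆-ℓ-⊙ (z , (x , _ , x∈A , (y , y∈B , refl) , z∈xℓy) , refl)
        with local x y (trans (D⇒r≡ℓ x (ℓ y) (z , z∈xℓy)) (ℓ-idem y))
      ... | w , w∈xy = w , (x , y , x∈A , y∈B , w∈xy) , trans (ℓ-⊙ w∈xy) (sym (ℓ-⊙ z∈xℓy))

      r-r-⊙-⊆-r-⊙ : image r (lift _⊙_ (image r A) B) ⊆ image r (lift _⊙_ A B)
      r-r-⊙-⊆-r-⊙ (z , (_ , y , (x , x∈A , refl) , y∈B , z∈rxy) , refl)
        with local x y (trans (sym (r-idem x)) (D⇒r≡ℓ (r x) y (z , z∈rxy)))
      ... | w , w∈xy = w , (x , y , x∈A , y∈B , w∈xy) , trans (r-⊙ w∈xy) (sym (r-⊙ z∈rxy))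

lemma6p3 : {X : Set} (_⊙_ : MultiOp X) (ℓ r : X → X)
    → IsLRMultisemigroup _⊙_ ℓ r
    → (A B : Pred X _)
    → (image ℓ (lift _⊙_ A B) ⊆ image ℓ (lift _⊙_ A (image ℓ B)))
      × (image r (lift _⊙_ A B) ⊆ image r (lift _⊙_ (image r A) B))
      × (IsLocal _⊙_ ℓ r
         → (image ℓ (lift _⊙_ A (image ℓ B)) ⊆ image ℓ (lift _⊙_ A B))
           × (image r (lift _⊙_ (image r A) B) ⊆ image r (lift _⊙_ A B)))
lemma6p3 _⊙_ ℓ r M A B =
  ℓ-⊙-⊆-ℓ-⊙-ℓ A B , r-⊙-⊆-r-r-⊙ A B ,
  λ local → ℓ-⊙-ℓ-⊆-ℓ-⊙ A B local , r-r-⊙-⊆-r-⊙ A B local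
  where open LRMultisemigroupProperties M
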